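{- The map $\sigma\mapsto\sigma/\tau(\sigma)$ is increasing on $(0,1]$. Furthermore, for every integer $\ell\ge1$ and $\sigma=1/\rho_{\ell+1}$, we have $\sigma/\tau(\sigma)=1/\rho_\ell$.
   Context: For $\ell\ge1$ let $\rho_\ell=1+\ell(\ell+1)/2$. Define $\tau:(0,1]\to[0,1]$ by: for $\sigma\in(0,1/2]$, let $\ell\ge1$ be the integer with $1/\rho_{\ell+1}<\sigma\le1/\rho_\ell$ and set $\tau(\sigma)=1-\frac{1}{\ell+1}-\frac{\rho_\ell-2}{\ell+1}\sigma$; for $\sigma>1/2$ set $\tau(\sigma)=1/2$.
   Formalization: The argument σ ranges over the rational numbers in (0,1], so τ and the map σ ↦ σ/τ(σ) are taken on rational points. -}

module Defs where

open import Data.Nat as ℕ using (ℕ; suc)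
open import Data.Integer as ℤ using (+_)
open import Data.Rational using (ℚ; _/_; _-_; _*_; _<_; _≤_; _>_; 0ℚ; 1ℚ; ½)
open import Data.Product using (Σ; _×_)
open import Data.Sum using (_⊎_)
open import Relation.Binary.PropositionalEquality using (_≡_)

-- ρ_ℓ = 1 + ℓ(ℓ+1)/2   (ℓ(ℓ+1) is even, so ℕ-division by 2 is exact)
ρ : ℕ → ℕ
ρ ℓ = 1 ℕ.+ (ℓ ℕ.* (ℓ ℕ.+ 1)) ℕ./ 2

inv-ρ : ℕ → ℚ
inv-ρ ℓ = + 1 / ρ ℓ

τ-formula : ℕ → ℚ → ℚ
τ-formula ℓ σ = 1ℚ - + 1 / (1 ℕ.+ ℓ) - ((+ ρ ℓ ℤ.- + 2) / (1 ℕ.+ ℓ)) * σ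

-- IsTau σ t  means  τ(σ) = t, following the piecewise definition literally.
IsTau : ℚ → ℚ → Set
IsTau σ t =
  (σ ≤ ½ × Σ ℕ (λ ℓ → (1 ℕ.≤ ℓ) × (inv-ρ (ℓ ℕ.+ 1) < σ) × (σ ≤ inv-ρ ℓ) × (t ≡ τ-formula ℓ σ)))
  ⊎ (σ > ½ × t ≡ ½)

{-# OPTIONS --safe #-}
-- On the ℓ-th piece 1/ρ_{ℓ+1} < σ ≤ 1/ρ_ℓ we have (ℓ+1)τ = ℓ − (ρ_ℓ − 2)σ. Since 2ρ_ℓ = 2 + ℓ(ℓ+1) and
-- ρ_{ℓ+1} = ρ_ℓ + ℓ + 1 this yields the identities
--   (ℓ+1)(ρ_ℓσ − τ) = ℓ(ρ_{ℓ+1}σ − 1) > 0   and   (ℓ+1)(τ − ρ_{ℓ−1}σ) = ℓ(1 − ρ_ℓσ) ≥ 0,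
-- so σ/τ ∈ (1/ρ_ℓ, 1/ρ_{ℓ−1}] on piece ℓ, while σ/τ = 2σ > 1 = 1/ρ₀ on the piece σ > ½. A larger σ lies on a
-- piece of smaller index, whose range of σ/τ lies above; within one piece σ/τ increases because
-- (ℓ+1)(σ₂τ(σ₁) − σ₁τ(σ₂)) = ℓ(σ₂ − σ₁). Finally σ = 1/ρ_{ℓ+1} lies on piece ℓ+1 and makes the second
-- identity vanish there, so τ = ρ_ℓσ.
module Submission where

open import Defs
open import Data.Nat as ℕ using (ℕ; zero; suc; z≤n; s≤s)
import Data.Nat.Properties as ℕₚ
import Data.Nat.DivMod as ℕ
import Data.Nat.Divisibility as ℕ
open import Data.Nat.Tactic.RingSolver using () renaming (solve-∀ to ℕ-solve)
open import Data.Integer.Tactic.RingSolver using () renaming (solve-∀ to ℤ-solve)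
open import Data.Integer as ℤ using (ℤ; +_)
import Data.Integer.Properties as ℤₚ
import Data.Rational.Unnormalised as ℚᵘ
import Data.Rational.Unnormalised.Properties as ℚᵘₚ
open import Data.Rational
open import Data.Rational.Properties
open import Data.Product using (Σ; ∃-syntax; _×_; _,_; proj₂)
open import Data.Sum using (inj₁; inj₂)
open import Level using (0ℓ)
open import Relation.Nullary using (¬_; Dec; yes; no; contradiction)
open import Relation.Nullary.Decidable.Core using (dec⇒maybe)
open import Relation.Unary using (Pred; Decidable)
open import Function.Bundles using (_⇔_; mk⇔; Equivalence)
open import Relation.Binary.PropositionalEquality
open import Tactic.RingSolver using (solve-∀)
open import Tactic.RingSolver.Core.AlmostCommutativeRing
  using (AlmostCommutativeRing; fromCommutativeRing)

-- Without the zero test the solver could not cancel rational coefficients.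
ℚ-ring : AlmostCommutativeRing 0ℓ 0ℓ
ℚ-ring = fromCommutativeRing +-*-commutativeRing (λ p → dec⇒maybe (0ℚ ≟ p))

-- The numbers ρ_ℓ

ρ-suc : ∀ ℓ → ρ (suc ℓ) ≡ ρ ℓ ℕ.+ suc ℓ
ρ-suc ℓ = cong suc (begin
  suc ℓ ℕ.* (suc ℓ ℕ.+ 1) ℕ./ 2                 ≡⟨ cong (ℕ._/ 2) (expand ℓ) ⟩
  (ℓ ℕ.* (ℓ ℕ.+ 1) ℕ.+ suc ℓ ℕ.* 2) ℕ./ 2       ≡⟨ ℕ.+-distrib-/-∣ʳ (ℓ ℕ.* (ℓ ℕ.+ 1)) (ℕ.divides-refl (suc ℓ)) ⟩
  ℓ ℕ.* (ℓ ℕ.+ 1) ℕ./ 2 ℕ.+ suc ℓ ℕ.* 2 ℕ./ 2   ≡⟨ cong (ℓ ℕ.* (ℓ ℕ.+ 1) ℕ./ 2 ℕ.+_) (ℕ.m*n/n≡m (suc ℓ) 2) ⟩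
  ℓ ℕ.* (ℓ ℕ.+ 1) ℕ./ 2 ℕ.+ suc ℓ               ∎)
  where
  open ≡-Reasoning
  expand : ∀ ℓ → suc ℓ ℕ.* (suc ℓ ℕ.+ 1) ≡ ℓ ℕ.* (ℓ ℕ.+ 1) ℕ.+ suc ℓ ℕ.* 2
  expand = ℕ-solve

ρ-mono-≤ : ∀ {ℓ m} → ℓ ℕ.≤ m → ρ ℓ ℕ.≤ ρ m
ρ-mono-≤ ℓ≤m = go (ℕₚ.≤⇒≤′ ℓ≤m)
  where
  go : ∀ {ℓ m} → ℓ ℕ.≤′ m → ρ ℓ ℕ.≤ ρ m
  go ℕ.≤′-refl = ℕₚ.≤-refl
  go (ℕ.≤′-step {m} ℓ≤′m) =
    ℕₚ.≤-trans (go ℓ≤′m) (subst (ρ m ℕ.≤_) (sym (ρ-suc m)) (ℕₚ.m≤m+n (ρ m) (suc m)))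

ρ-<-suc : ∀ ℓ → ρ ℓ ℕ.< ρ (suc ℓ)
ρ-<-suc ℓ rewrite ρ-suc ℓ = ℕₚ.m<m+n (ρ ℓ) (s≤s z≤n)

n<ρn : ∀ n → n ℕ.< ρ n
n<ρn zero    = s≤s z≤n
n<ρn (suc n) rewrite ρ-suc n = ℕₚ.+-monoˡ-≤ (suc n) (s≤s z≤n)

-- Integers and naturals as rationals

fromℚᵘ-homo-+ : ∀ p q → fromℚᵘ (p ℚᵘ.+ q) ≡ fromℚᵘ p + fromℚᵘ q
fromℚᵘ-homo-+ p q = toℚᵘ-injective (ℚᵘₚ.≃-trans (toℚᵘ-fromℚᵘ _) (ℚᵘₚ.≃-sym (ℚᵘₚ.≃-trans
  (toℚᵘ-homo-+ (fromℚᵘ p) (fromℚᵘ q)) (ℚᵘₚ.+-cong (toℚᵘ-fromℚᵘ p) (toℚᵘ-fromℚᵘ q)))))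

fromℚᵘ-homo-* : ∀ p q → fromℚᵘ (p ℚᵘ.* q) ≡ fromℚᵘ p * fromℚᵘ q
fromℚᵘ-homo-* p q = toℚᵘ-injective (ℚᵘₚ.≃-trans (toℚᵘ-fromℚᵘ _) (ℚᵘₚ.≃-sym (ℚᵘₚ.≃-trans
  (toℚᵘ-homo-* (fromℚᵘ p) (fromℚᵘ q)) (ℚᵘₚ.*-cong (toℚᵘ-fromℚᵘ p) (toℚᵘ-fromℚᵘ q)))))

fromℚᵘ-homo‿- : ∀ p → fromℚᵘ (ℚᵘ.- p) ≡ - fromℚᵘ p
fromℚᵘ-homo‿- p = toℚᵘ-injective (ℚᵘₚ.≃-trans (toℚᵘ-fromℚᵘ _) (ℚᵘₚ.≃-sym (ℚᵘₚ.≃-trans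
  (toℚᵘ-homo‿- (fromℚᵘ p)) (ℚᵘₚ.-‿cong (toℚᵘ-fromℚᵘ p)))))

fromℤ : ℤ → ℚ
fromℤ i = i / 1

fromℕ : ℕ → ℚ
fromℕ n = fromℤ (+ n)

fromℤ-homo-+ : ∀ i j → fromℤ (i ℤ.+ j) ≡ fromℤ i + fromℤ j
fromℤ-homo-+ i j = trans (fromℚᵘ-cong {ℚᵘ.mkℚᵘ (i ℤ.+ j) 0} {ℚᵘ.mkℚᵘ i 0 ℚᵘ.+ ℚᵘ.mkℚᵘ j 0} (ℚᵘ.*≡* (cross-multiplied i j)))
  (fromℚᵘ-homo-+ (ℚᵘ.mkℚᵘ i 0) (ℚᵘ.mkℚᵘ j 0))
  where
  cross-multiplied : ∀ i j → (i ℤ.+ j) ℤ.* + 1 ≡ (i ℤ.* + 1 ℤ.+ j ℤ.* + 1) ℤ.* + 1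
  cross-multiplied = ℤ-solve

fromℤ-homo‿- : ∀ i → fromℤ (ℤ.- i) ≡ - fromℤ i
fromℤ-homo‿- i = fromℚᵘ-homo‿- (ℚᵘ.mkℚᵘ i 0)

fromℤ-mono-≤ : ∀ {i j} → i ℤ.≤ j → fromℤ i ≤ fromℤ j
fromℤ-mono-≤ {i} {j} i≤j = toℚᵘ-cancel-≤ (ℚᵘₚ.≤-respˡ-≃ (ℚᵘₚ.≃-sym (toℚᵘ-fromℚᵘ (ℚᵘ.mkℚᵘ i 0)))
  (ℚᵘₚ.≤-respʳ-≃ (ℚᵘₚ.≃-sym (toℚᵘ-fromℚᵘ (ℚᵘ.mkℚᵘ j 0)))
    (ℚᵘ.*≤* (subst₂ ℤ._≤_ (sym (ℤₚ.*-identityʳ i)) (sym (ℤₚ.*-identityʳ j)) i≤j))))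

fromℤ-mono-< : ∀ {i j} → i ℤ.< j → fromℤ i < fromℤ j
fromℤ-mono-< {i} {j} i<j = toℚᵘ-cancel-< (ℚᵘₚ.<-respˡ-≃ (ℚᵘₚ.≃-sym (toℚᵘ-fromℚᵘ (ℚᵘ.mkℚᵘ i 0)))
  (ℚᵘₚ.<-respʳ-≃ (ℚᵘₚ.≃-sym (toℚᵘ-fromℚᵘ (ℚᵘ.mkℚᵘ j 0)))
    (ℚᵘ.*<* (subst₂ ℤ._<_ (sym (ℤₚ.*-identityʳ i)) (sym (ℤₚ.*-identityʳ j)) i<j))))

fromℕ-homo-+ : ∀ m n → fromℕ (m ℕ.+ n) ≡ fromℕ m + fromℕ n
fromℕ-homo-+ m n = fromℤ-homo-+ (+ m) (+ n)

fromℕ-suc : ∀ n → fromℕ (suc n) ≡ 1ℚ + fromℕ n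
fromℕ-suc = fromℕ-homo-+ 1

fromℕ-mono-≤ : ∀ {m n} → m ℕ.≤ n → fromℕ m ≤ fromℕ n
fromℕ-mono-≤ {m} {n} m≤n = fromℤ-mono-≤ {+ m} {+ n} (ℤ.+≤+ m≤n)

fromℕ-mono-< : ∀ {m n} → m ℕ.< n → fromℕ m < fromℕ n
fromℕ-mono-< {m} {n} m<n = fromℤ-mono-< {+ m} {+ n} (ℤ.+<+ m<n)

0≤fromℕ : ∀ n → 0ℚ ≤ fromℕ n
0≤fromℕ n = fromℕ-mono-≤ {0} {n} z≤n

0<fromℕ-suc : ∀ n → 0ℚ < fromℕ (suc n)
0<fromℕ-suc n = fromℕ-mono-< {0} {suc n} (s≤s z≤n)

/-as-* : ∀ i d → i / suc d ≡ fromℤ i * (+ 1 / suc d)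
/-as-* i d = trans (fromℚᵘ-cong {ℚᵘ.mkℚᵘ i d} {ℚᵘ.mkℚᵘ i 0 ℚᵘ.* ℚᵘ.mkℚᵘ (+ 1) d} (ℚᵘ.*≡* (cross-multiplied i d)))
  (fromℚᵘ-homo-* (ℚᵘ.mkℚᵘ i 0) (ℚᵘ.mkℚᵘ (+ 1) d))
  where
  cross-multiplied : ∀ i d → i ℤ.* + suc (d ℕ.+ 0) ≡ (i ℤ.* + 1) ℤ.* + suc d
  cross-multiplied i d rewrite ℕₚ.+-identityʳ d | ℤₚ.*-identityʳ i = refl

1/n*n≡1 : ∀ d → (+ 1 / suc d) * fromℕ (suc d) ≡ 1ℚ
1/n*n≡1 d = trans (sym (fromℚᵘ-homo-* (ℚᵘ.mkℚᵘ (+ 1) d) (ℚᵘ.mkℚᵘ (+ suc d) 0)))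
  (fromℚᵘ-cong {ℚᵘ.mkℚᵘ (+ 1) d ℚᵘ.* ℚᵘ.mkℚᵘ (+ suc d) 0} {ℚᵘ.mkℚᵘ (+ 1) 0} (ℚᵘ.*≡* (cross-multiplied d)))
  where
  cross-multiplied : ∀ d → (+ 1 ℤ.* + suc d) ℤ.* + 1 ≡ + 1 ℤ.* + suc (d ℕ.* 1)
  cross-multiplied d rewrite ℕₚ.*-identityʳ d | ℤₚ.*-identityʳ (+ 1 ℤ.* + suc d) = refl

p*↧p≡↥p : ∀ p → p * fromℕ (↧ₙ p) ≡ fromℤ (↥ p)
p*↧p≡↥p p@(mkℚ n d _) = begin
  p * fromℕ (suc d)                             ≡⟨ cong (λ r → r * fromℕ (suc d)) (sym (↥p/↧p≡p p)) ⟩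
  (n / suc d) * fromℕ (suc d)                   ≡⟨ cong (_* fromℕ (suc d)) (/-as-* n d) ⟩
  fromℤ n * (+ 1 / suc d) * fromℕ (suc d)       ≡⟨ *-assoc (fromℤ n) _ _ ⟩
  fromℤ n * ((+ 1 / suc d) * fromℕ (suc d))     ≡⟨ cong (fromℤ n *_) (1/n*n≡1 d) ⟩
  fromℤ n * 1ℚ                                  ≡⟨ *-identityʳ (fromℤ n) ⟩
  fromℤ n                                       ∎
  where open ≡-Reasoning

1≤↥p : ∀ {p} → 0ℚ < p → 1ℚ ≤ fromℤ (↥ p)
1≤↥p {p} 0<p with ↥ p | subst (+ 0 ℤ.<_) (ℤₚ.*-identityʳ (↥ p)) (drop-*<* 0<p)
... | + n | ℤ.+<+ 0<n = fromℤ-mono-≤ {+ 1} {+ n} (ℤ.+≤+ 0<n)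

ρ̂ : ℚ → ℚ
ρ̂ x = 1ℚ + x * (x + 1ℚ) * ½

ρ̂-step : ∀ x → ρ̂ x + (1ℚ + x) ≡ ρ̂ (1ℚ + x)
ρ̂-step = expanded
  where
  -- ρ̂ is spelled out here and below because the solver does not unfold definitions.
  expanded : ∀ x → 1ℚ + x * (x + 1ℚ) * ½ + (1ℚ + x) ≡ 1ℚ + (1ℚ + x) * ((1ℚ + x) + 1ℚ) * ½
  expanded = solve-∀ ℚ-ring

ρℚ-suc : ∀ ℓ → fromℕ (ρ (suc ℓ)) ≡ fromℕ (ρ ℓ) + fromℕ (suc ℓ)
ρℚ-suc ℓ = trans (cong fromℕ (ρ-suc ℓ)) (fromℕ-homo-+ (ρ ℓ) (suc ℓ))

fromℕ-ρ : ∀ ℓ → fromℕ (ρ ℓ) ≡ ρ̂ (fromℕ ℓ)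
fromℕ-ρ zero    = refl
fromℕ-ρ (suc ℓ) = begin
  fromℕ (ρ (suc ℓ))               ≡⟨ ρℚ-suc ℓ ⟩
  fromℕ (ρ ℓ) + fromℕ (suc ℓ)     ≡⟨ cong₂ _+_ (fromℕ-ρ ℓ) (fromℕ-suc ℓ) ⟩
  ρ̂ (fromℕ ℓ) + (1ℚ + fromℕ ℓ)    ≡⟨ ρ̂-step (fromℕ ℓ) ⟩
  ρ̂ (1ℚ + fromℕ ℓ)                ≡⟨ cong ρ̂ (sym (fromℕ-suc ℓ)) ⟩
  ρ̂ (fromℕ (suc ℓ))               ∎
  where open ≡-Reasoning

ρ*inv-ρ≡1 : ∀ ℓ → fromℕ (ρ ℓ) * inv-ρ ℓ ≡ 1ℚ
ρ*inv-ρ≡1 ℓ = trans (*-comm (fromℕ (ρ ℓ)) (inv-ρ ℓ)) (1/n*n≡1 (ℓ ℕ.* (ℓ ℕ.+ 1) ℕ./ 2))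

0<ρ : ∀ ℓ → 0ℚ < fromℕ (ρ ℓ)
0<ρ ℓ = 0<fromℕ-suc (ℓ ℕ.* (ℓ ℕ.+ 1) ℕ./ 2)

-- Order and division in ℚ

pos*pos : ∀ {p q} → 0ℚ < p → 0ℚ < q → 0ℚ < p * q
pos*pos {p} {q} 0<p 0<q = positive⁻¹ (p * q) {{pos*pos⇒pos p {{positive 0<p}} q {{positive 0<q}}}}

nonNeg*nonNeg : ∀ {p q} → 0ℚ ≤ p → 0ℚ ≤ q → 0ℚ ≤ p * q
nonNeg*nonNeg {p} {q} 0≤p 0≤q = nonNegative⁻¹ (p * q) {{nonNeg*nonNeg⇒nonNeg p {{nonNegative 0≤p}} q {{nonNegative 0≤q}}}}

p+[q-p]≡q : ∀ p q → p + (q - p) ≡ q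
p+[q-p]≡q = solve-∀ ℚ-ring

0<q-p⇒p<q : ∀ {p q} → 0ℚ < q - p → p < q
0<q-p⇒p<q {p} {q} 0<q-p = subst₂ _<_ (+-identityʳ p) (p+[q-p]≡q p q) (+-monoʳ-< p 0<q-p)

0≤q-p⇒p≤q : ∀ {p q} → 0ℚ ≤ q - p → p ≤ q
0≤q-p⇒p≤q {p} {q} 0≤q-p = subst₂ _≤_ (+-identityʳ p) (p+[q-p]≡q p q) (+-monoʳ-≤ p 0≤q-p)

p<q⇒0<q-p : ∀ {p q} → p < q → 0ℚ < q - p
p<q⇒0<q-p {p} {q} p<q = subst (_< q - p) (+-inverseʳ p) (+-monoˡ-< (- p) p<q)

p≤q⇒0≤q-p : ∀ {p q} → p ≤ q → 0ℚ ≤ q - p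
p≤q⇒0≤q-p {p} {q} p≤q = subst (_≤ q - p) (+-inverseʳ p) (+-monoˡ-≤ (- p) p≤q)

module _ {c p q d : ℚ} (0<c : 0ℚ < c) (gap : c * q - c * p ≡ d) where

  <-by-gap : 0ℚ < d → p < q
  <-by-gap 0<d = *-cancelˡ-<-nonNeg c {{nonNegative (<⇒≤ 0<c)}} (0<q-p⇒p<q (subst (0ℚ <_) (sym gap) 0<d))

  ≤-by-gap : 0ℚ ≤ d → p ≤ q
  ≤-by-gap 0≤d = *-cancelˡ-≤-pos c {{positive 0<c}} (0≤q-p⇒p≤q (subst (0ℚ ≤_) (sym gap) 0≤d))

≡-by-gap : ∀ {c p q} → 0ℚ < c → c * q - c * p ≡ 0ℚ → p ≡ q
≡-by-gap {c} {p} {q} 0<c gap = ≤-antisym (≤-by-gap 0<c gap ≤-refl)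
  (≤-by-gap 0<c (trans (antisymmetric c p q) (cong -_ gap)) ≤-refl)
  where
  antisymmetric : ∀ c p q → c * p - c * q ≡ - (c * q - c * p)
  antisymmetric = solve-∀ ℚ-ring

module _ {c d : ℚ} (0<c : 0ℚ < c) (c*d≡1 : c * d ≡ 1ℚ) where

  ≤-reciprocal : ∀ {p} → p ≤ d ⇔ c * p ≤ 1ℚ
  ≤-reciprocal {p} = mk⇔
    (λ p≤d → subst (c * p ≤_) c*d≡1 (*-monoˡ-≤-nonNeg c {{nonNegative (<⇒≤ 0<c)}} p≤d))
    (λ cp≤1 → *-cancelˡ-≤-pos c {{positive 0<c}} (subst (c * p ≤_) (sym c*d≡1) cp≤1))

  <-reciprocal : ∀ {p} → d < p ⇔ 1ℚ < c * p
  <-reciprocal {p} = mk⇔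
    (λ d<p → subst (_< c * p) c*d≡1 (*-monoʳ-<-pos c {{positive 0<c}} d<p))
    (λ 1<cp → *-cancelˡ-<-nonNeg c {{nonNegative (<⇒≤ 0<c)}} (subst (_< c * p) (sym c*d≡1) 1<cp))

cross-<⇒÷<÷ : ∀ {p₁ p₂ q₁ q₂} .{{_ : NonZero q₁}} .{{_ : NonZero q₂}} → 0ℚ < q₁ → 0ℚ < q₂ →
        p₁ * q₂ < p₂ * q₁ → p₁ ÷ q₁ < p₂ ÷ q₂
cross-<⇒÷<÷ {p₁} {p₂} {q₁} {q₂} 0<q₁ 0<q₂ p₁q₂<p₂q₁ =
  *-cancelʳ-<-nonNeg (q₁ * q₂) {{nonNegative (<⇒≤ (pos*pos 0<q₁ 0<q₂))}}
    (subst₂ _<_ (sym (cancel p₁ q₁ q₂)) (sym (trans (cong (p₂ * (1/ q₂) *_) (*-comm q₁ q₂)) (cancel p₂ q₂ q₁)))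
      p₁q₂<p₂q₁)
  where
  cancel : ∀ p q r .{{_ : NonZero q}} → p * (1/ q) * (q * r) ≡ p * r
  cancel p q r = begin
    p * (1/ q) * (q * r)   ≡⟨ regroup p (1/ q) q r ⟩
    p * r * (1/ q * q)     ≡⟨ cong (p * r *_) (*-inverseˡ q) ⟩
    p * r * 1ℚ             ≡⟨ *-identityʳ (p * r) ⟩
    p * r                  ∎
    where
    open ≡-Reasoning
    regroup : ∀ p w q r → p * w * (q * r) ≡ p * r * (w * q)
    regroup = solve-∀ ℚ-ring

q*r≡p⇒p÷q≡r : ∀ {p q r} .{{_ : NonZero q}} → q * r ≡ p → p ÷ q ≡ r
q*r≡p⇒p÷q≡r {p} {q} {r} q*r≡p = begin
  p * (1/ q)         ≡⟨ cong (_* (1/ q)) (sym q*r≡p) ⟩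
  q * r * (1/ q)     ≡⟨ regroup q r (1/ q) ⟩
  r * (q * (1/ q))   ≡⟨ cong (r *_) (*-inverseʳ q) ⟩
  r * 1ℚ             ≡⟨ *-identityʳ r ⟩
  r                  ∎
  where
  open ≡-Reasoning
  regroup : ∀ q r w → q * r * w ≡ r * (q * w)
  regroup = solve-∀ ℚ-ring

-- The pieces of τ

τ-formula-scaled : ∀ ℓ σ → fromℕ (suc ℓ) * τ-formula ℓ σ ≡ fromℕ ℓ - (fromℕ (ρ ℓ) - fromℕ 2) * σ
τ-formula-scaled ℓ σ = begin
  fromℕ (suc ℓ) * τ-formula ℓ σ
    ≡⟨ cong₂ (λ n s → n * (1ℚ - c - s * σ)) (fromℕ-suc ℓ) slope ⟩
  (1ℚ + l) * (1ℚ - c - (R - fromℕ 2) * c * σ)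
    ≡⟨ expand l c R σ ⟩
  l - (R - fromℕ 2) * σ + (1ℚ - c * (1ℚ + l)) * (1ℚ + (R - fromℕ 2) * σ)
    ≡⟨ cong (λ u → l - (R - fromℕ 2) * σ + (1ℚ - u) * (1ℚ + (R - fromℕ 2) * σ)) c*[1+l]≡1 ⟩
  l - (R - fromℕ 2) * σ + (1ℚ - 1ℚ) * (1ℚ + (R - fromℕ 2) * σ)
    ≡⟨ drop-zero (l - (R - fromℕ 2) * σ) (1ℚ + (R - fromℕ 2) * σ) ⟩
  l - (R - fromℕ 2) * σ
    ∎
  where
  open ≡-Reasoning
  l = fromℕ ℓ
  R = fromℕ (ρ ℓ)
  c = + 1 / suc ℓ
  slope : (+ ρ ℓ ℤ.- + 2) / suc ℓ ≡ (R - fromℕ 2) * c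
  slope = trans (/-as-* (+ ρ ℓ ℤ.- + 2) ℓ)
    (cong (_* c) (trans (fromℤ-homo-+ (+ ρ ℓ) (ℤ.- + 2)) (cong (λ r → R + r) (fromℤ-homo‿- (+ 2)))))
  c*[1+l]≡1 : c * (1ℚ + l) ≡ 1ℚ
  c*[1+l]≡1 = trans (cong (c *_) (sym (fromℕ-suc ℓ))) (1/n*n≡1 ℓ)
  expand : ∀ l c R σ → (1ℚ + l) * (1ℚ - c - (R - fromℕ 2) * c * σ)
                     ≡ l - (R - fromℕ 2) * σ + (1ℚ - c * (1ℚ + l)) * (1ℚ + (R - fromℕ 2) * σ)
  expand = solve-∀ ℚ-ring
  drop-zero : ∀ p q → p + (1ℚ - 1ℚ) * q ≡ p
  drop-zero = solve-∀ ℚ-ring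

τ-formula-upper-gap : ∀ ℓ σ → fromℕ (suc ℓ) * (fromℕ (ρ ℓ) * σ) - fromℕ (suc ℓ) * τ-formula ℓ σ
                              ≡ fromℕ ℓ * (fromℕ (ρ (suc ℓ)) * σ - 1ℚ)
τ-formula-upper-gap ℓ σ = begin
  N * (R * σ) - N * τ-formula ℓ σ           ≡⟨ cong (λ u → N * (R * σ) - u) (τ-formula-scaled ℓ σ) ⟩
  N * (R * σ) - (y - (R - fromℕ 2) * σ)     ≡⟨ identity (fromℕ-suc ℓ) (fromℕ-ρ ℓ) (ρℚ-suc ℓ) ⟩
  y * (fromℕ (ρ (suc ℓ)) * σ - 1ℚ)          ∎
  where
  open ≡-Reasoning
  y = fromℕ ℓ
  N = fromℕ (suc ℓ)
  R = fromℕ (ρ ℓ)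
  polynomial : ∀ y σ → (1ℚ + y) * ((1ℚ + y * (y + 1ℚ) * ½) * σ) - (y - ((1ℚ + y * (y + 1ℚ) * ½) - fromℕ 2) * σ)
                       ≡ y * (((1ℚ + y * (y + 1ℚ) * ½) + (1ℚ + y)) * σ - 1ℚ)
  polynomial = solve-∀ ℚ-ring
  identity : ∀ {N R R₊} → N ≡ 1ℚ + y → R ≡ ρ̂ y → R₊ ≡ R + N →
             N * (R * σ) - (y - (R - fromℕ 2) * σ) ≡ y * (R₊ * σ - 1ℚ)
  identity refl refl refl = polynomial y σ

τ-formula-lower-gap : ∀ m σ → fromℕ (2 ℕ.+ m) * τ-formula (suc m) σ - fromℕ (2 ℕ.+ m) * (fromℕ (ρ m) * σ)
                              ≡ fromℕ (suc m) * (1ℚ - fromℕ (ρ (suc m)) * σ)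
τ-formula-lower-gap m σ = begin
  N * τ-formula (suc m) σ - N * (R₋ * σ)          ≡⟨ cong (_- N * (R₋ * σ)) (τ-formula-scaled (suc m) σ) ⟩
  (y - (R - fromℕ 2) * σ) - N * (R₋ * σ)          ≡⟨ identity (fromℕ-suc (suc m)) (fromℕ-ρ (suc m)) R₋≡R-y ⟩
  y * (1ℚ - R * σ)                                ∎
  where
  open ≡-Reasoning
  y = fromℕ (suc m)
  N = fromℕ (2 ℕ.+ m)
  R = fromℕ (ρ (suc m))
  R₋ = fromℕ (ρ m)
  R₋≡R-y : R₋ ≡ R - y
  R₋≡R-y = trans (cancel R₋ y) (cong (_- y) (sym (ρℚ-suc m)))
    where
    cancel : ∀ p q → p ≡ p + q - q
    cancel = solve-∀ ℚ-ring
  polynomial : ∀ y σ → (y - ((1ℚ + y * (y + 1ℚ) * ½) - fromℕ 2) * σ) - (1ℚ + y) * (((1ℚ + y * (y + 1ℚ) * ½) - y) * σ)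
                       ≡ y * (1ℚ - (1ℚ + y * (y + 1ℚ) * ½) * σ)
  polynomial = solve-∀ ℚ-ring
  identity : ∀ {N R R₋} → N ≡ 1ℚ + y → R ≡ ρ̂ y → R₋ ≡ R - y →
             (y - (R - fromℕ 2) * σ) - N * (R₋ * σ) ≡ y * (1ℚ - R * σ)
  identity refl refl refl = polynomial y σ

τ-formula-slope : ∀ ℓ σ₁ σ₂ → fromℕ (suc ℓ) * (σ₂ * τ-formula ℓ σ₁) - fromℕ (suc ℓ) * (σ₁ * τ-formula ℓ σ₂)
                              ≡ fromℕ ℓ * (σ₂ - σ₁)
τ-formula-slope ℓ σ₁ σ₂ = begin
  N * (σ₂ * τ-formula ℓ σ₁) - N * (σ₁ * τ-formula ℓ σ₂)
    ≡⟨ regroup N σ₁ σ₂ (τ-formula ℓ σ₁) (τ-formula ℓ σ₂) ⟩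
  σ₂ * (N * τ-formula ℓ σ₁) - σ₁ * (N * τ-formula ℓ σ₂)
    ≡⟨ cong₂ (λ u v → σ₂ * u - σ₁ * v) (τ-formula-scaled ℓ σ₁) (τ-formula-scaled ℓ σ₂) ⟩
  σ₂ * (y - K * σ₁) - σ₁ * (y - K * σ₂)
    ≡⟨ cross y K σ₁ σ₂ ⟩
  y * (σ₂ - σ₁)
    ∎
  where
  open ≡-Reasoning
  y = fromℕ ℓ
  N = fromℕ (suc ℓ)
  K = fromℕ (ρ ℓ) - fromℕ 2
  regroup : ∀ N σ₁ σ₂ t₁ t₂ → N * (σ₂ * t₁) - N * (σ₁ * t₂) ≡ σ₂ * (N * t₁) - σ₁ * (N * t₂)
  regroup = solve-∀ ℚ-ring
  cross : ∀ y K σ₁ σ₂ → σ₂ * (y - K * σ₁) - σ₁ * (y - K * σ₂) ≡ y * (σ₂ - σ₁)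
  cross = solve-∀ ℚ-ring

τ-on : ℕ → ℚ → ℚ
τ-on zero    σ = ½
τ-on (suc m) σ = τ-formula (suc m) σ

-- Since ρ₀ = 1 and ρ₁ = 2, piece 0 (σ ∈ (½, 1]) has the same shape 1/ρ_{k+1} < σ ≤ 1/ρ_k as the others.
record Piece (k : ℕ) (σ t : ℚ) : Set where
  field
    above : 1ℚ < fromℕ (ρ (suc k)) * σ
    below : fromℕ (ρ k) * σ ≤ 1ℚ
    value : t ≡ τ-on k σ

0<½ : 0ℚ < ½
0<½ = positive⁻¹ ½

piece-lower : ∀ {m σ t} → Piece (suc m) σ t → fromℕ (ρ m) * σ ≤ t
piece-lower {m} {σ} record { below = below ; value = refl } =
  ≤-by-gap (0<fromℕ-suc (suc m)) (τ-formula-lower-gap m σ)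
    (nonNeg*nonNeg (0≤fromℕ (suc m)) (p≤q⇒0≤q-p below))

piece-upper : ∀ {k σ t} → Piece k σ t → t < fromℕ (ρ k) * σ
piece-upper {zero} {σ} record { above = above ; value = refl } =
  subst (½ <_) (sym (*-identityˡ σ)) (Equivalence.from (<-reciprocal (0<fromℕ-suc 1) refl) above)
piece-upper {suc m} {σ} record { above = above ; value = refl } =
  <-by-gap (0<fromℕ-suc (suc m)) (τ-formula-upper-gap (suc m) σ) (pos*pos (0<fromℕ-suc m) (p<q⇒0<q-p above))

piece-pos : ∀ {k σ t} → 0ℚ < σ → Piece k σ t → 0ℚ < t
piece-pos {zero}  _   record { value = refl } = 0<½
piece-pos {suc m} 0<σ P = <-≤-trans (pos*pos (0<ρ m) 0<σ) (piece-lower P)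

piece-slope : ∀ {k σ₁ σ₂ t₁ t₂} → σ₁ < σ₂ → Piece k σ₁ t₁ → Piece k σ₂ t₂ → σ₁ * t₂ < σ₂ * t₁
piece-slope {zero} σ₁<σ₂ record { value = refl } record { value = refl } = *-monoˡ-<-pos ½ σ₁<σ₂
piece-slope {suc m} {σ₁} {σ₂} σ₁<σ₂ record { value = refl } record { value = refl } =
  <-by-gap (0<fromℕ-suc (suc m)) (τ-formula-slope (suc m) σ₁ σ₂) (pos*pos (0<fromℕ-suc m) (p<q⇒0<q-p σ₁<σ₂))

piece-at-breakpoint : ∀ {m σ t} → Piece (suc m) σ t → fromℕ (ρ (suc m)) * σ ≡ 1ℚ → t ≡ fromℕ (ρ m) * σ
piece-at-breakpoint {m} {σ} record { value = refl } ρσ≡1 =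
  sym (≡-by-gap (0<fromℕ-suc (suc m)) (begin
    _                                                ≡⟨ τ-formula-lower-gap m σ ⟩
    fromℕ (suc m) * (1ℚ - fromℕ (ρ (suc m)) * σ)     ≡⟨ cong (λ u → fromℕ (suc m) * (1ℚ - u)) ρσ≡1 ⟩
    fromℕ (suc m) * (1ℚ - 1ℚ)                        ≡⟨ *-zeroʳ (fromℕ (suc m)) ⟩
    0ℚ                                               ∎))
  where open ≡-Reasoning

ρ-bounds⇒≤ : ∀ {j k σ} → 0ℚ < σ → fromℕ (ρ j) * σ ≤ 1ℚ → 1ℚ < fromℕ (ρ (suc k)) * σ → j ℕ.≤ k
ρ-bounds⇒≤ {j} {k} {σ} 0<σ ρⱼσ≤1 1<ρₖ₊₁σ with j ℕ.≤? k
... | yes j≤k = j≤k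
... | no  j≰k = contradiction (<-≤-trans 1<ρₖ₊₁σ (≤-trans ρₖ₊₁σ≤ρⱼσ ρⱼσ≤1)) (<-irrefl refl)
  where
  ρₖ₊₁σ≤ρⱼσ : fromℕ (ρ (suc k)) * σ ≤ fromℕ (ρ j) * σ
  ρₖ₊₁σ≤ρⱼσ = *-monoʳ-≤-nonNeg σ {{nonNegative (<⇒≤ 0<σ)}} (fromℕ-mono-≤ (ρ-mono-≤ (ℕₚ.≰⇒> j≰k)))

1<ρσ⇔ : ∀ ℓ {σ} → inv-ρ ℓ < σ ⇔ 1ℚ < fromℕ (ρ ℓ) * σ
1<ρσ⇔ ℓ = <-reciprocal (0<ρ ℓ) (ρ*inv-ρ≡1 ℓ)

ρσ≤1⇔ : ∀ ℓ {σ} → σ ≤ inv-ρ ℓ ⇔ fromℕ (ρ ℓ) * σ ≤ 1ℚ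
ρσ≤1⇔ ℓ = ≤-reciprocal (0<ρ ℓ) (ρ*inv-ρ≡1 ℓ)

IsTau⇒Piece : ∀ {σ t} → σ ≤ 1ℚ → IsTau σ t → ∃[ k ] Piece k σ t
IsTau⇒Piece {σ} σ≤1 (inj₂ (½<σ , refl)) = zero , record
  { above = Equivalence.to (<-reciprocal (0<fromℕ-suc 1) refl) ½<σ
  ; below = subst (_≤ 1ℚ) (sym (*-identityˡ σ)) σ≤1
  ; value = refl
  }
IsTau⇒Piece {σ} _ (inj₁ (_ , suc m , _ , ρ₊⁻¹<σ , σ≤ρ⁻¹ , refl)) = suc m , record
  { above = Equivalence.to (1<ρσ⇔ (2 ℕ.+ m)) (subst (λ n → inv-ρ n < σ) (ℕₚ.+-comm (suc m) 1) ρ₊⁻¹<σ)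
  ; below = Equivalence.to (ρσ≤1⇔ (suc m)) σ≤ρ⁻¹
  ; value = refl
  }

pieces-descending : ∀ {m k σ₁ σ₂ t₁ t₂} → 0ℚ < σ₁ → 0ℚ < σ₂ → k ℕ.≤ m →
                    Piece (suc m) σ₁ t₁ → Piece k σ₂ t₂ → σ₁ * t₂ < σ₂ * t₁
pieces-descending {m} {k} {σ₁} {σ₂} {t₁} {t₂} 0<σ₁ 0<σ₂ k≤m P₁ P₂ = begin-strict
  σ₁ * t₂                      <⟨ *-monoʳ-<-pos σ₁ {{positive 0<σ₁}} (piece-upper P₂) ⟩
  σ₁ * (fromℕ (ρ k) * σ₂)      ≤⟨ *-monoˡ-≤-nonNeg σ₁ {{nonNegative (<⇒≤ 0<σ₁)}}
                                    (*-monoʳ-≤-nonNeg σ₂ {{nonNegative (<⇒≤ 0<σ₂)}} (fromℕ-mono-≤ (ρ-mono-≤ k≤m))) ⟩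
  σ₁ * (fromℕ (ρ m) * σ₂)      ≡⟨ swap σ₁ (fromℕ (ρ m)) σ₂ ⟩
  σ₂ * (fromℕ (ρ m) * σ₁)      ≤⟨ *-monoˡ-≤-nonNeg σ₂ {{nonNegative (<⇒≤ 0<σ₂)}} (piece-lower P₁) ⟩
  σ₂ * t₁                      ∎
  where
  open ≤-Reasoning
  swap : ∀ p r q → p * (r * q) ≡ q * (r * p)
  swap = solve-∀ ℚ-ring

piece-index-antitone : ∀ {k₁ k₂ σ₁ σ₂ t₁ t₂} → 0ℚ < σ₁ → σ₁ ≤ σ₂ →
                       Piece k₁ σ₁ t₁ → Piece k₂ σ₂ t₂ → k₂ ℕ.≤ k₁
piece-index-antitone {k₂ = k₂} 0<σ₁ σ₁≤σ₂ P₁ P₂ = ρ-bounds⇒≤ 0<σ₁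
  (≤-trans (*-monoˡ-≤-nonNeg (fromℕ (ρ k₂)) {{nonNegative (<⇒≤ (0<ρ k₂))}} σ₁≤σ₂) (Piece.below P₂))
  (Piece.above P₁)

pieces-increasing : ∀ {k₁ k₂ σ₁ σ₂ t₁ t₂} → 0ℚ < σ₁ → σ₁ < σ₂ →
                    Piece k₁ σ₁ t₁ → Piece k₂ σ₂ t₂ → σ₁ * t₂ < σ₂ * t₁
pieces-increasing 0<σ₁ σ₁<σ₂ P₁ P₂ with ℕₚ.m≤n⇒m<n∨m≡n (piece-index-antitone 0<σ₁ (<⇒≤ σ₁<σ₂) P₁ P₂)
... | inj₂ refl       = piece-slope σ₁<σ₂ P₁ P₂
... | inj₁ (s≤s k₂≤m) = pieces-descending 0<σ₁ (<-trans 0<σ₁ σ₁<σ₂) k₂≤m P₁ P₂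

crossing : ∀ {p} {P : Pred ℕ p} → Decidable P → ∀ {a} b → a ℕ.≤ b → P a → ¬ P b →
           ∃[ ℓ ] a ℕ.≤ ℓ × P ℓ × ¬ P (suc ℓ)
crossing {P = P} P? zero a≤0 Pa ¬P0 = contradiction (subst P (ℕₚ.n≤0⇒n≡0 a≤0) Pa) ¬P0
crossing {P = P} P? (suc b) a≤1+b Pa ¬P1+b with ℕₚ.m≤n⇒m<n∨m≡n a≤1+b
... | inj₂ refl     = contradiction Pa ¬P1+b
... | inj₁ (s≤s a≤b) with P? b
...   | yes Pb = b , a≤b , Pb , ¬P1+b
...   | no ¬Pb = crossing P? b a≤b Pa ¬Pb

1<ρ[↧p]*p : ∀ {p} → 0ℚ < p → 1ℚ < fromℕ (ρ (↧ₙ p)) * p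
1<ρ[↧p]*p {p} 0<p = begin-strict
  1ℚ                          ≤⟨ 1≤↥p 0<p ⟩
  fromℤ (↥ p)                 ≡⟨ sym (p*↧p≡↥p p) ⟩
  p * fromℕ (↧ₙ p)            <⟨ *-monoʳ-<-pos p {{positive 0<p}} (fromℕ-mono-< (ℕₚ.n<1+n (↧ₙ p))) ⟩
  p * fromℕ (suc (↧ₙ p))      ≤⟨ *-monoˡ-≤-nonNeg p {{nonNegative (<⇒≤ 0<p)}} (fromℕ-mono-≤ (n<ρn (↧ₙ p))) ⟩
  p * fromℕ (ρ (↧ₙ p))        ≡⟨ *-comm p (fromℕ (ρ (↧ₙ p))) ⟩
  fromℕ (ρ (↧ₙ p)) * p        ∎
  where open ≤-Reasoning

τ-exists : ∀ σ → 0ℚ < σ → σ ≤ 1ℚ → Σ ℚ (λ t → IsTau σ t × t > 0ℚ)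
τ-exists σ 0<σ σ≤1 = by-cases (σ ≤? ½)
  where
  from-crossing : σ ≤ ½ → ∃[ ℓ ] 1 ℕ.≤ ℓ × fromℕ (ρ ℓ) * σ ≤ 1ℚ × ¬ (fromℕ (ρ (suc ℓ)) * σ ≤ 1ℚ) →
                  Σ ℚ (λ t → IsTau σ t × t > 0ℚ)
  from-crossing σ≤½ (suc m , 1≤ℓ , ρσ≤1 , ρ₊σ≰1) =
    τ-formula (suc m) σ , inj₁ (σ≤½ , suc m , 1≤ℓ , ρ₊⁻¹<σ , σ≤ρ⁻¹ , refl) , piece-pos {suc m} 0<σ P
    where
    P : Piece (suc m) σ (τ-formula (suc m) σ)
    P = record { above = ≰⇒> ρ₊σ≰1 ; below = ρσ≤1 ; value = refl }
    ρ₊⁻¹<σ : inv-ρ (suc m ℕ.+ 1) < σ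
    ρ₊⁻¹<σ = subst (λ n → inv-ρ n < σ) (ℕₚ.+-comm 1 (suc m)) (Equivalence.from (1<ρσ⇔ (2 ℕ.+ m)) (Piece.above P))
    σ≤ρ⁻¹ : σ ≤ inv-ρ (suc m)
    σ≤ρ⁻¹ = Equivalence.from (ρσ≤1⇔ (suc m)) ρσ≤1
  by-cases : Dec (σ ≤ ½) → Σ ℚ (λ t → IsTau σ t × t > 0ℚ)
  by-cases (no σ≰½)  = ½ , inj₂ (≰⇒> σ≰½ , refl) , 0<½
  by-cases (yes σ≤½) = from-crossing σ≤½ (crossing (λ n → fromℕ (ρ n) * σ ≤? 1ℚ) (↧ₙ σ) (s≤s z≤n)
    (Equivalence.to (≤-reciprocal (0<fromℕ-suc 1) refl) σ≤½)
    (λ ρσ≤1 → <-irrefl refl (<-≤-trans (1<ρ[↧p]*p 0<σ) ρσ≤1)))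

0<inv-ρ : ∀ ℓ → 0ℚ < inv-ρ ℓ
0<inv-ρ ℓ = positive⁻¹ (inv-ρ ℓ) {{normalize-pos 1 (ρ ℓ)}}

inv-ρ≤1 : ∀ ℓ → inv-ρ ℓ ≤ 1ℚ
inv-ρ≤1 ℓ = begin
  inv-ρ ℓ                   ≡⟨ sym (*-identityʳ (inv-ρ ℓ)) ⟩
  inv-ρ ℓ * 1ℚ              ≤⟨ *-monoˡ-≤-nonNeg (inv-ρ ℓ) {{nonNegative (<⇒≤ (0<inv-ρ ℓ))}} (fromℕ-mono-≤ {1} {ρ ℓ} (s≤s z≤n)) ⟩
  inv-ρ ℓ * fromℕ (ρ ℓ)     ≡⟨ *-comm (inv-ρ ℓ) (fromℕ (ρ ℓ)) ⟩
  fromℕ (ρ ℓ) * inv-ρ ℓ     ≡⟨ ρ*inv-ρ≡1 ℓ ⟩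
  1ℚ                        ∎
  where open ≤-Reasoning

piece-index-at-breakpoint : ∀ {k ℓ t} → Piece k (inv-ρ (suc ℓ)) t → k ≡ suc ℓ
piece-index-at-breakpoint {k} {ℓ} P = ℕₚ.≤-antisym
  (ρ-bounds⇒≤ (0<inv-ρ (suc ℓ)) (Piece.below P)
    (subst (_< fromℕ (ρ (2 ℕ.+ ℓ)) * σ) (ρ*inv-ρ≡1 (suc ℓ))
      (*-monoˡ-<-pos σ {{positive (0<inv-ρ (suc ℓ))}} (fromℕ-mono-< (ρ-<-suc (suc ℓ))))))
  (ρ-bounds⇒≤ (0<inv-ρ (suc ℓ)) (≤-reflexive (ρ*inv-ρ≡1 (suc ℓ))) (Piece.above P))
  where σ = inv-ρ (suc ℓ)

t*inv-ρ≡inv-ρ₊ : ∀ {ℓ t} → Piece (suc ℓ) (inv-ρ (suc ℓ)) t → t * inv-ρ ℓ ≡ inv-ρ (suc ℓ)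
t*inv-ρ≡inv-ρ₊ {ℓ} {t} P = begin
  t * inv-ρ ℓ                    ≡⟨ cong (_* inv-ρ ℓ) (piece-at-breakpoint P (ρ*inv-ρ≡1 (suc ℓ))) ⟩
  fromℕ (ρ ℓ) * σ * inv-ρ ℓ      ≡⟨ swap (fromℕ (ρ ℓ)) σ (inv-ρ ℓ) ⟩
  σ * (fromℕ (ρ ℓ) * inv-ρ ℓ)    ≡⟨ cong (σ *_) (ρ*inv-ρ≡1 ℓ) ⟩
  σ * 1ℚ                         ≡⟨ *-identityʳ σ ⟩
  σ                              ∎
  where
  open ≡-Reasoning
  σ = inv-ρ (suc ℓ)
  swap : ∀ r p q → r * p * q ≡ p * (r * q)
  swap = solve-∀ ℚ-ring

σ/τ-at-breakpoint : ∀ ℓ t .{{_ : NonZero t}} → IsTau (inv-ρ (suc ℓ)) t → inv-ρ (suc ℓ) ÷ t ≡ inv-ρ ℓ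
σ/τ-at-breakpoint ℓ t T = q*r≡p⇒p÷q≡r {inv-ρ (suc ℓ)} {t}
  (t*inv-ρ≡inv-ρ₊ {ℓ} (subst (λ k → Piece k (inv-ρ (suc ℓ)) t) (piece-index-at-breakpoint P) P))
  where
  P = proj₂ (IsTau⇒Piece (inv-ρ≤1 (suc ℓ)) T)

σ/τ-increasing : ∀ σ₁ σ₂ t₁ t₂ .{{_ : NonZero t₁}} .{{_ : NonZero t₂}} →
                 0ℚ < σ₁ → σ₁ < σ₂ → σ₂ ≤ 1ℚ → IsTau σ₁ t₁ → IsTau σ₂ t₂ → σ₁ ÷ t₁ < σ₂ ÷ t₂
σ/τ-increasing σ₁ σ₂ t₁ t₂ 0<σ₁ σ₁<σ₂ σ₂≤1 T₁ T₂ =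
  cross-<⇒÷<÷ {σ₁} {σ₂} {t₁} {t₂} (piece-pos 0<σ₁ P₁) (piece-pos (<-trans 0<σ₁ σ₁<σ₂) P₂)
    (pieces-increasing 0<σ₁ σ₁<σ₂ P₁ P₂)
  where
  P₁ = proj₂ (IsTau⇒Piece (≤-trans (<⇒≤ σ₁<σ₂) σ₂≤1) T₁)
  P₂ = proj₂ (IsTau⇒Piece σ₂≤1 T₂)

proposition1 :
    -- τ is defined and positive on (0,1], so σ/τ(σ) makes sense
    ((σ : ℚ) → 0ℚ < σ → σ ≤ 1ℚ → Σ ℚ (λ t → IsTau σ t × t > 0ℚ))
    -- σ ↦ σ/τ(σ) is (strictly) increasing on (0,1]
    × ((σ₁ σ₂ t₁ t₂ : ℚ) → .{{_ : NonZero t₁}} → .{{_ : NonZero t₂}} →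
        0ℚ < σ₁ → σ₁ < σ₂ → σ₂ ≤ 1ℚ → IsTau σ₁ t₁ → IsTau σ₂ t₂ →
        (σ₁ ÷ t₁) < (σ₂ ÷ t₂))
    -- for ℓ ≥ 1 and σ = 1/ρ_{ℓ+1}: σ/τ(σ) = 1/ρ_ℓ
    × ((ℓ : ℕ) → 1 ℕ.≤ ℓ → (t : ℚ) → .{{_ : NonZero t}} →
        IsTau (inv-ρ (ℓ ℕ.+ 1)) t → (inv-ρ (ℓ ℕ.+ 1) ÷ t) ≡ inv-ρ ℓ)
proposition1 = τ-exists , σ/τ-increasing , λ ℓ _ → at-breakpoint ℓ
  where
  at-breakpoint : ∀ ℓ t .{{_ : NonZero t}} → IsTau (inv-ρ (ℓ ℕ.+ 1)) t → inv-ρ (ℓ ℕ.+ 1) ÷ t ≡ inv-ρ ℓ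
  at-breakpoint ℓ = subst (λ n → ∀ t .{{_ : NonZero t}} → IsTau (inv-ρ n) t → inv-ρ n ÷ t ≡ inv-ρ ℓ)
                          (ℕₚ.+-comm 1 ℓ) (σ/τ-at-breakpoint ℓ)
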